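{- $F_0^M(x,y,q)=1$, $F_1^M(x,y,q)=x$, and for $n\geq 2$, $$F_n^M(x,y,q)=xq^{n-1}F_{n-1}^M(x,y,q)+yq^{n-2}F_{n-2}^M(x,y,q).$$
   Context: $S_n(123,132,213)$ denotes the set of permutations of $[n]$ containing no subsequence order isomorphic to $123$, $132$ or $213$. For a permutation $\pi$, split it into maximal increasing runs of consecutive entries (for $\pi\in S_n(123,132,213)$ these are its layers: $\pi$ is a concatenation of increasing blocks of size $1$ or $2$, each block larger than all later blocks). Let $s(\pi)$ (resp. $d(\pi)$) be the number of such runs of length $1$ (resp. $2$). For $\pi=p_1\dots p_n$, $maj(\pi)=\sum_{i:\,p_i>p_{i+1}} i$. Define $F_n^M(x,y,q)=\sum_{\pi\in S_n(123,132,213)}x^{s(\pi)}y^{d(\pi)}q^{maj(\pi)}$. -}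

module Defs where

open import Data.Bool using (Bool; true; false; _∧_; _∨_; not; if_then_else_)
open import Data.Nat using (ℕ; zero; suc; _+_; _∸_; _≤ᵇ_; _<ᵇ_; _≡ᵇ_)
open import Data.List using (List; []; _∷_; _++_; upTo; length; map; concatMap; filterᵇ; zip)
open import Data.Bool.ListAction using (any; all)
open import Data.Product using (_×_; _,_)
open import Relation.Binary.PropositionalEquality using (_≡_)

-- Permutations of [n] = {1,…,n} are represented as words p₁ … pₙ (lists of ℕ).

words : ℕ → ℕ → List (List ℕ)
words zero    k = [] ∷ []
words (suc n) k = concatMap (λ w → map (λ a → a ∷ w) (map suc (upTo k))) (words n k)

notIn : ℕ → List ℕ → Bool
notIn b []       = true
notIn b (c ∷ cs) = not (b ≡ᵇ c) ∧ notIn b cs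

distinct : List ℕ → Bool
distinct []       = true
distinct (a ∷ as) = notIn a as ∧ distinct as

perms : ℕ → List (List ℕ)
perms n = filterᵇ distinct (words n n)

subseqs : List ℕ → List (List ℕ)
subseqs []       = [] ∷ []
subseqs (a ∷ as) = map (a ∷_) (subseqs as) ++ subseqs as

orderIso : List ℕ → List ℕ → Bool
orderIso []       []       = true
orderIso []       (_ ∷ _)  = false
orderIso (_ ∷ _)  []       = false
orderIso (u ∷ us) (v ∷ vs) =
  (length us ≡ᵇ length vs)
  ∧ all (λ { (u′ , v′) → (u <ᵇ u′) ≡ᵇB (v <ᵇ v′) }) (zip us vs)
  ∧ orderIso us vs
  where
  _≡ᵇB_ : Bool → Bool → Bool
  true  ≡ᵇB b = b
  false ≡ᵇB b = not b

contains : List ℕ → List ℕ → Bool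
contains π σ = any (λ u → orderIso u σ) (subseqs π)

avoids : List ℕ → List ℕ → Bool
avoids π σ = not (contains π σ)

Av : ℕ → List (List ℕ)
Av n = filterᵇ (λ π → avoids π (1 ∷ 2 ∷ 3 ∷ []) ∧ avoids π (1 ∷ 3 ∷ 2 ∷ [])
                        ∧ avoids π (2 ∷ 1 ∷ 3 ∷ [])) (perms n)

-- lengths of the maximal increasing runs of consecutive entries (ascending runs)
-- runsFrom a r ps : the current run ends with entry a and has length r so far
runsFrom : ℕ → ℕ → List ℕ → List ℕ
runsFrom a r []       = r ∷ []
runsFrom a r (b ∷ bs) = if a <ᵇ b then runsFrom b (suc r) bs else r ∷ runsFrom b 1 bs

runs : List ℕ → List ℕ
runs []       = []
runs (a ∷ as) = runsFrom a 1 as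

countEq : ℕ → List ℕ → ℕ
countEq k xs = length (filterᵇ (k ≡ᵇ_) xs)

sRuns dRuns : List ℕ → ℕ
sRuns π = countEq 1 (runs π)
dRuns π = countEq 2 (runs π)

-- maj(π) = Σ_{i : p_i > p_{i+1}} i  (positions 1-indexed); majFrom i ps : ps starts at position i
majFrom : ℕ → List ℕ → ℕ
majFrom i []           = 0
majFrom i (a ∷ [])     = 0
majFrom i (a ∷ b ∷ bs) = (if b <ᵇ a then i else 0) + majFrom (suc i) (b ∷ bs)

maj : List ℕ → ℕ
maj = majFrom 1

-- Polynomials in ℕ[x,y,q], given by their coefficient functions:
-- P a b c = coefficient of x^a y^b q^c.
Poly : Set
Poly = ℕ → ℕ → ℕ → ℕ

FM : ℕ → Poly
FM n a b c = length (filterᵇ (λ π → (sRuns π ≡ᵇ a) ∧ (dRuns π ≡ᵇ b) ∧ (maj π ≡ᵇ c)) (Av n))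

mono : ℕ → ℕ → ℕ → Poly
mono i j k a b c = if (a ≡ᵇ i) ∧ (b ≡ᵇ j) ∧ (c ≡ᵇ k) then 1 else 0

mulMono : ℕ → ℕ → ℕ → Poly → Poly
mulMono i j k P a b c = if (i ≤ᵇ a) ∧ (j ≤ᵇ b) ∧ (k ≤ᵇ c) then P (a ∸ i) (b ∸ j) (c ∸ k) else 0

_+P_ : Poly → Poly → Poly
(P +P Q) a b c = P a b c + Q a b c

_≈P_ : Poly → Poly → Set
P ≈P Q = ∀ a b c → P a b c ≡ Q a b c

-- A permutation avoids 123, 132 and 213 exactly when p_i > p_k whenever k ≥ i + 2: each of the
-- three patterns is a subsequence x y z with x < z, and every such subsequence is an occurrence
-- of one of them. If π = ρ u v has this property, v lies below every entry of ρ, so the minimum 1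
-- of a permutation of [n] is u or v: either π ends with u 1, or it ends with 1 v and then v = 2 by
-- pigeonhole on ρ. Removing this last layer 1 (resp. 1 2) and lowering the other entries by 1
-- (resp. 2) leaves a member of S_{n-1}(123,132,213) (resp. S_{n-2}(123,132,213)), so as a bag
-- S_n(123,132,213) is the list of skew sums σ ⊖ 1 and σ ⊖ 12. The layer 1 contributes a run of
-- length 1 and the descent at n - 1, the layer 12 a run of length 2 and the descent at n - 2, and
-- all other runs and descents of σ are kept; this gives the two monomial factors.

module Submission where

open import Defs
open import Algebra.Bundles using (CommutativeMonoid)
open import Data.Bool using (Bool; true; false; _∧_; _∨_; not; T; if_then_else_)
open import Data.Bool.ListAction using (any; or)
open import Data.Bool.Properties
  using (∨-assoc; ∨-identityʳ; ∨-conicalˡ; ∨-conicalʳ; ∨-commutativeMonoid; ∧-commutativeMonoid;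
         ∨-∧-booleanAlgebra; T-∧; T-not-≡; T?)
open import Data.Empty using (⊥-elim)
open import Data.List
  using (List; []; _∷_; _++_; map; drop; length; concatMap; cartesianProductWith; upTo; filter; filterᵇ)
open import Data.List.Membership.Propositional using (_∈_)
open import Data.List.Membership.Propositional.Properties
  using (∈-map⁺; ∈-map⁻; ∈-++⁺ˡ; ∈-++⁺ʳ; ∈-++⁻; ∈-upTo⁺; ∈-upTo⁻; ∈-filter⁺; ∈-filter⁻;
         ∈-cartesianProductWith⁺; ∈-cartesianProductWith⁻)
open import Data.List.Membership.Propositional.Properties.WithK using (unique∧set⇒bag)
open import Data.List.Properties
  using (map-cong; map-∘; map-injective; length-map; length-++; length-++-comm; ++-assoc; ++-cancelʳ;
         ∷ʳ-injectiveʳ; filter-++; filter-all; filter-accept; filter-reject)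
open import Data.List.Relation.Binary.BagAndSetEquality using (∼bag⇒↭)
open import Data.List.Relation.Binary.Permutation.Propositional using (_↭_; ↭-sym)
open import Data.List.Relation.Binary.Permutation.Propositional.Properties using (filter-↭; ↭-length)
open import Data.List.Relation.Unary.All using (All; []; _∷_)
import Data.List.Relation.Unary.All as All
import Data.List.Relation.Unary.All.Properties as Allₚ
open import Data.List.Relation.Unary.Any using (here; there)
open import Data.List.Relation.Unary.Unique.Propositional using (Unique; []; _∷_)
import Data.List.Relation.Unary.Unique.Propositional.Properties as UP
open import Data.Nat
  using (ℕ; zero; suc; _+_; _∸_; _<_; _≤_; _<ᵇ_; _≤ᵇ_; _≡ᵇ_; _≟_; z<s; z≤n; s≤s; s≤s⁻¹)
open import Data.Nat.Properties
  using (≤-refl; ≤-reflexive; ≤-trans; ≤-antisym; <-irrefl; <-trans; <-≤-trans; <-cmp; <⇒≤; <⇒≱; ≤⇒≯;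
         ≮⇒≥; ≤∧≢⇒<; n≮0; suc-injective; +-comm; +-assoc; +-suc; +-identityʳ; +-cancelˡ-≡; +-cancelˡ-≤;
         +-monoʳ-≤; m≤m+n; m≤n+m; m<m+n; +-∸-assoc; ∸-monoˡ-≤; m+[n∸m]≡n; m<n⇒0<n∸m; m≤n+o⇒m∸n≤o;
         m≤o∸n⇒m+n≤o; <ᵇ-reflects-<; <⇒<ᵇ; ≡ᵇ⇒≡; ≡⇒≡ᵇ; module ≤-Reasoning)
open import Data.Product using (_×_; _,_; proj₁; proj₂; ∃-syntax)
open import Data.Sum using (inj₁; inj₂)
open import Data.Unit using (⊤; tt)
open import Function using (_∘_; Equivalence; mk⇔)
open import Relation.Binary.Definitions using (tri<; tri≈; tri>)
open import Relation.Binary.PropositionalEquality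
  using (_≡_; _≢_; _≗_; refl; sym; trans; cong; cong₂; subst; ≢-sym; module ≡-Reasoning)
open import Relation.Nullary using (¬_; Dec; ¬?; yes; no)
open import Relation.Nullary.Reflects using (Reflects; ofʸ; ofⁿ; det; invert; fromEquivalence)

open import Algebra.Lattice.Properties.BooleanAlgebra ∨-∧-booleanAlgebra using (deMorgan₂)
open import Algebra.Properties.CommutativeSemigroup (CommutativeMonoid.commutativeSemigroup ∨-commutativeMonoid)
  using () renaming (interchange to ∨-interchange)
open import Algebra.Properties.CommutativeSemigroup (CommutativeMonoid.commutativeSemigroup ∧-commutativeMonoid)
  using () renaming (interchange to ∧-interchange)

any-++ : ∀ {A : Set} (f : A → Bool) xs ys → any f (xs ++ ys) ≡ any f xs ∨ any f ys
any-++ f []       ys = refl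
any-++ f (x ∷ xs) ys = trans (cong (f x ∨_) (any-++ f xs ys)) (sym (∨-assoc (f x) _ _))

any-false : ∀ {A : Set} (xs : List A) → any (λ _ → false) xs ≡ false
any-false []       = refl
any-false (_ ∷ xs) = any-false xs

any-cong : ∀ {A : Set} {f g : A → Bool} → f ≗ g → any f ≗ any g
any-cong f≗g xs = cong or (map-cong f≗g xs)

any-∨ : ∀ {A : Set} (f g : A → Bool) xs → any f xs ∨ any g xs ≡ any (λ x → f x ∨ g x) xs
any-∨ f g []       = refl
any-∨ f g (x ∷ xs) = trans (∨-interchange (f x) (any f xs) (g x) (any g xs))
                           (cong ((f x ∨ g x) ∨_) (any-∨ f g xs))

≥⇒<ᵇ≡false : ∀ {x y} → y ≤ x → (x <ᵇ y) ≡ false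
≥⇒<ᵇ≡false y≤x = det (<ᵇ-reflects-< _ _) (ofⁿ (≤⇒≯ y≤x))

<ᵇ≡false⇒≥ : ∀ {x y} → (x <ᵇ y) ≡ false → y ≤ x
<ᵇ≡false⇒≥ e = ≮⇒≥ (λ x<y → subst T e (<⇒<ᵇ x<y))

any<ᵇ≡false⇒All≤ : ∀ x ys → any (x <ᵇ_) ys ≡ false → All (_≤ x) ys
any<ᵇ≡false⇒All≤ x []       _ = []
any<ᵇ≡false⇒All≤ x (y ∷ ys) e =
  <ᵇ≡false⇒≥ (∨-conicalˡ _ _ e) ∷ any<ᵇ≡false⇒All≤ x ys (∨-conicalʳ _ _ e)

All≤⇒any<ᵇ≡false : ∀ x {ys} → All (_≤ x) ys → any (x <ᵇ_) ys ≡ false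
All≤⇒any<ᵇ≡false x []           = refl
All≤⇒any<ᵇ≡false x (y≤x ∷ ys≤x) = cong₂ _∨_ (≥⇒<ᵇ≡false y≤x) (All≤⇒any<ᵇ≡false x ys≤x)

≡ᵇ-reflects-≡ : ∀ m n → Reflects (m ≡ n) (m ≡ᵇ n)
≡ᵇ-reflects-≡ m n = fromEquivalence (≡ᵇ⇒≡ m n) (≡⇒≡ᵇ m n)


-- Avoiding 123, 132 and 213 as a condition on entries two apart

lowHigh : List ℕ → Bool
lowHigh (x ∷ _ ∷ z ∷ []) = x <ᵇ z
lowHigh _                = false

orderIso-123∨132∨213 : ∀ u →
  orderIso u (1 ∷ 2 ∷ 3 ∷ []) ∨ orderIso u (1 ∷ 3 ∷ 2 ∷ []) ∨ orderIso u (2 ∷ 1 ∷ 3 ∷ []) ≡ lowHigh u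
orderIso-123∨132∨213 []                    = refl
orderIso-123∨132∨213 (_ ∷ [])              = refl
orderIso-123∨132∨213 (_ ∷ _ ∷ [])          = refl
orderIso-123∨132∨213 (_ ∷ _ ∷ _ ∷ _ ∷ _)   = refl
orderIso-123∨132∨213 (x ∷ y ∷ z ∷ [])
  with x <ᵇ y | x <ᵇ z | y <ᵇ z | <ᵇ-reflects-< x y | <ᵇ-reflects-< x z | <ᵇ-reflects-< y z
... | true  | true  | true  | _ | _ | _ = refl
... | true  | true  | false | _ | _ | _ = refl
... | true  | false | true  | _ | _ | _ = refl
... | true  | false | false | _ | _ | _ = refl
... | false | true  | true  | _ | _ | _ = refl
... | false | true  | false | ofⁿ x≮y | ofʸ x<z | ofⁿ y≮z =
  ⊥-elim (<-irrefl refl (≤-trans x<z (≤-trans (≮⇒≥ y≮z) (≮⇒≥ x≮y))))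
... | false | false | true  | _ | _ | _ = refl
... | false | false | false | _ | _ | _ = refl

avoids-123-132-213 : ∀ π →
  avoids π (1 ∷ 2 ∷ 3 ∷ []) ∧ avoids π (1 ∷ 3 ∷ 2 ∷ []) ∧ avoids π (2 ∷ 1 ∷ 3 ∷ [])
    ≡ not (any lowHigh (subseqs π))
avoids-123-132-213 π = begin
  not c₁ ∧ not c₂ ∧ not c₃        ≡⟨ cong (not c₁ ∧_) (sym (deMorgan₂ c₂ c₃)) ⟩
  not c₁ ∧ not (c₂ ∨ c₃)          ≡⟨ sym (deMorgan₂ c₁ (c₂ ∨ c₃)) ⟩
  not (c₁ ∨ c₂ ∨ c₃)              ≡⟨ cong not (trans (cong (c₁ ∨_) (any-∨ iso₂ iso₃ ss))
                                                     (any-∨ iso₁ _ ss)) ⟩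
  not (any (λ u → iso₁ u ∨ iso₂ u ∨ iso₃ u) ss)
                                  ≡⟨ cong not (any-cong orderIso-123∨132∨213 ss) ⟩
  not (any lowHigh ss)            ∎
  where
  open ≡-Reasoning
  ss = subseqs π
  iso₁ iso₂ iso₃ : List ℕ → Bool
  iso₁ u = orderIso u (1 ∷ 2 ∷ 3 ∷ [])
  iso₂ u = orderIso u (1 ∷ 3 ∷ 2 ∷ [])
  iso₃ u = orderIso u (2 ∷ 1 ∷ 3 ∷ [])
  c₁ = any iso₁ ss
  c₂ = any iso₂ ss
  c₃ = any iso₃ ss

any-subseqs-∷ : ∀ (f : List ℕ → Bool) c cs →
  any f (subseqs (c ∷ cs)) ≡ any (f ∘ (c ∷_)) (subseqs cs) ∨ any f (subseqs cs)
any-subseqs-∷ f c cs = trans (any-++ f (map (c ∷_) (subseqs cs)) (subseqs cs))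
  (cong (λ b → or b ∨ any f (subseqs cs)) (sym (map-∘ (subseqs cs))))

lowHigh-subseqs₃ : ∀ x y z cs → any (λ u → lowHigh (x ∷ y ∷ z ∷ u)) (subseqs cs) ≡ (x <ᵇ z)
lowHigh-subseqs₃ x y z []       = ∨-identityʳ (x <ᵇ z)
lowHigh-subseqs₃ x y z (c ∷ cs) = begin
  any (λ u → lowHigh (x ∷ y ∷ z ∷ u)) (subseqs (c ∷ cs))
    ≡⟨ any-subseqs-∷ (λ u → lowHigh (x ∷ y ∷ z ∷ u)) c cs ⟩
  any (λ _ → false) (subseqs cs) ∨ any (λ u → lowHigh (x ∷ y ∷ z ∷ u)) (subseqs cs)
    ≡⟨ cong₂ _∨_ (any-false (subseqs cs)) (lowHigh-subseqs₃ x y z cs) ⟩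
  x <ᵇ z ∎
  where open ≡-Reasoning

lowHigh-subseqs₂ : ∀ x y cs → any (λ u → lowHigh (x ∷ y ∷ u)) (subseqs cs) ≡ any (x <ᵇ_) cs
lowHigh-subseqs₂ x y []       = refl
lowHigh-subseqs₂ x y (c ∷ cs) = trans (any-subseqs-∷ (λ u → lowHigh (x ∷ y ∷ u)) c cs)
  (cong₂ _∨_ (lowHigh-subseqs₃ x y c cs) (lowHigh-subseqs₂ x y cs))

GapDecreasing : List ℕ → Set
GapDecreasing []       = ⊤
GapDecreasing (a ∷ as) = All (_≤ a) (drop 1 as) × GapDecreasing as

lowHigh-subseqs₁⁻ : ∀ x cs → any (λ u → lowHigh (x ∷ u)) (subseqs cs) ≡ false → All (_≤ x) (drop 1 cs)
lowHigh-subseqs₁⁻ x []       _ = []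
lowHigh-subseqs₁⁻ x (c ∷ cs) e =
  any<ᵇ≡false⇒All≤ x cs
    (trans (sym (lowHigh-subseqs₂ x c cs)) (∨-conicalˡ _ _ (trans (sym (any-subseqs-∷ _ c cs)) e)))

lowHigh-subseqs₁⁺ : ∀ x cs → All (_≤ x) (drop 1 cs) → any (λ u → lowHigh (x ∷ u)) (subseqs cs) ≡ false
lowHigh-subseqs₁⁺ x []       _     = refl
lowHigh-subseqs₁⁺ x (c ∷ cs) cs≤x = trans (any-subseqs-∷ _ c cs)
  (cong₂ _∨_ (trans (lowHigh-subseqs₂ x c cs) (All≤⇒any<ᵇ≡false x cs≤x))
             (lowHigh-subseqs₁⁺ x cs (Allₚ.drop⁺ 1 cs≤x)))

noLowHigh⇒gapDecreasing : ∀ π → any lowHigh (subseqs π) ≡ false → GapDecreasing π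
noLowHigh⇒gapDecreasing []       _ = tt
noLowHigh⇒gapDecreasing (c ∷ cs) e with trans (sym (any-subseqs-∷ lowHigh c cs)) e
... | e′ = lowHigh-subseqs₁⁻ c cs (∨-conicalˡ _ _ e′) , noLowHigh⇒gapDecreasing cs (∨-conicalʳ _ _ e′)

gapDecreasing⇒noLowHigh : ∀ π → GapDecreasing π → any lowHigh (subseqs π) ≡ false
gapDecreasing⇒noLowHigh []       _            = refl
gapDecreasing⇒noLowHigh (c ∷ cs) (cs≤c , gcs) = trans (any-subseqs-∷ lowHigh c cs)
  (cong₂ _∨_ (lowHigh-subseqs₁⁺ c cs cs≤c) (gapDecreasing⇒noLowHigh cs gcs))


Between : ℕ → ℕ → ℕ → Set
Between lo hi a = lo < a × a ≤ hi

record IsAv (n : ℕ) (π : List ℕ) : Set where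
  constructor isAv
  field
    length≡       : length π ≡ n
    between       : All (Between 0 n) π
    unique        : Unique π
    gapDecreasing : GapDecreasing π

concatMap-map≡cartesianProductWith : ∀ {A B C : Set} (f : A → B → C) xs ys →
  concatMap (λ x → map (f x) ys) xs ≡ cartesianProductWith f xs ys
concatMap-map≡cartesianProductWith f []       ys = refl
concatMap-map≡cartesianProductWith f (x ∷ xs) ys =
  cong (map (f x) ys ++_) (concatMap-map≡cartesianProductWith f xs ys)

words-suc : ∀ n k → words (suc n) k ≡ cartesianProductWith (λ w a → a ∷ w) (words n k) (map suc (upTo k))
words-suc n k = concatMap-map≡cartesianProductWith _ (words n k) _

∈words⁻ : ∀ n k {π} → π ∈ words n k → length π ≡ n × All (Between 0 k) π
∈words⁻ zero    k (here refl) = refl , []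
∈words⁻ (suc n) k π∈
  with w , a , w∈ , a∈ , refl ← ∈-cartesianProductWith⁻ _ (words n k) _
                                  (subst (_ ∈_) (words-suc n k) π∈)
  with i , i∈ , refl ← ∈-map⁻ suc a∈
  with len , ws ← ∈words⁻ n k w∈
  = cong suc len , (z<s , ∈-upTo⁻ i∈) ∷ ws

∈words⁺ : ∀ n k {π} → length π ≡ n → All (Between 0 k) π → π ∈ words n k
∈words⁺ zero    k {[]}        refl []                = here refl
∈words⁺ (suc n) k {suc i ∷ w} refl ((_ , i<k) ∷ ws) = subst (_ ∈_) (sym (words-suc n k))
  (∈-cartesianProductWith⁺ _ (∈words⁺ n k refl ws) (∈-map⁺ suc (∈-upTo⁺ i<k)))

words-unique : ∀ n k → Unique (words n k)
words-unique zero    k = [] ∷ []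
words-unique (suc n) k = subst Unique (sym (words-suc n k))
  (UP.cartesianProductWith⁺ _ ∷-injective′ (words-unique n k) (UP.map⁺ suc-injective (UP.upTo⁺ k)))
  where
  ∷-injective′ : ∀ {w w′ : List ℕ} {a a′} → a ∷ w ≡ a′ ∷ w′ → w ≡ w′ × a ≡ a′
  ∷-injective′ refl = refl , refl

notIn⇒All≢ : ∀ b cs → T (notIn b cs) → All (b ≢_) cs
notIn⇒All≢ b []       _ = []
notIn⇒All≢ b (c ∷ cs) t with b≢ᵇc , t′ ← Equivalence.to T-∧ t =
  invert (subst (Reflects _) (Equivalence.to T-not-≡ b≢ᵇc) (≡ᵇ-reflects-≡ b c))
    ∷ notIn⇒All≢ b cs t′

All≢⇒notIn : ∀ b {cs} → All (b ≢_) cs → T (notIn b cs)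
All≢⇒notIn b []           = tt
All≢⇒notIn b (b≢c ∷ b≢cs) = Equivalence.from T-∧
  (Equivalence.from T-not-≡ (det (≡ᵇ-reflects-≡ _ _) (ofⁿ b≢c)) , All≢⇒notIn b b≢cs)

distinct⇒unique : ∀ π → T (distinct π) → Unique π
distinct⇒unique []       _ = []
distinct⇒unique (a ∷ as) t with t₁ , t₂ ← Equivalence.to T-∧ t =
  notIn⇒All≢ a as t₁ ∷ distinct⇒unique as t₂

unique⇒distinct : ∀ {π} → Unique π → T (distinct π)
unique⇒distinct []           = tt
unique⇒distinct (a∉ ∷ uas) = Equivalence.from T-∧ (All≢⇒notIn _ a∉ , unique⇒distinct uas)

∈Av⇒isAv : ∀ n {π} → π ∈ Av n → IsAv n π
∈Av⇒isAv n {π} π∈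
  with π∈perms , avoidsπ ← ∈-filter⁻ (T? ∘ _) π∈
  with π∈words , distinctπ ← ∈-filter⁻ (T? ∘ distinct) π∈perms
  with len , btw ← ∈words⁻ n n π∈words
  = isAv len btw (distinct⇒unique π distinctπ)
      (noLowHigh⇒gapDecreasing π (Equivalence.to T-not-≡ (subst T (avoids-123-132-213 π) avoidsπ)))

isAv⇒∈Av : ∀ n {π} → IsAv n π → π ∈ Av n
isAv⇒∈Av n {π} (isAv len btw u g) =
  ∈-filter⁺ (T? ∘ _) (∈-filter⁺ (T? ∘ distinct) (∈words⁺ n n len btw) (unique⇒distinct u))
    (subst T (sym (avoids-123-132-213 π)) (Equivalence.from T-not-≡ (gapDecreasing⇒noLowHigh π g)))

Av-unique : ∀ n → Unique (Av n)
Av-unique n = UP.filter⁺ (T? ∘ _) (UP.filter⁺ (T? ∘ distinct) (words-unique n n))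


gapDecreasing-map : ∀ {f : ℕ → ℕ} → (∀ {x y} → x ≤ y → f x ≤ f y) →
  ∀ {xs} → GapDecreasing xs → GapDecreasing (map f xs)
gapDecreasing-map mono {[]}         _        = tt
gapDecreasing-map mono {_ ∷ []}     _        = [] , tt
gapDecreasing-map mono {_ ∷ _ ∷ _}  (p , g)  = Allₚ.map⁺ (All.map mono p) , gapDecreasing-map mono g

gapDecreasing-++ : ∀ {xs ys} → GapDecreasing xs → GapDecreasing ys →
  All (λ x → All (_≤ x) ys) xs → GapDecreasing (xs ++ ys)
gapDecreasing-++ {[]}        _       gys _               = gys
gapDecreasing-++ {_ ∷ []}    _       gys (ys≤a ∷ [])     = Allₚ.drop⁺ 1 ys≤a , gys
gapDecreasing-++ {_ ∷ _ ∷ _} (p , g) gys (ys≤a ∷ ys≤xs) = Allₚ.++⁺ p ys≤a , gapDecreasing-++ g gys ys≤xs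

gapDecreasing-++⁻ˡ : ∀ xs {ys} → GapDecreasing (xs ++ ys) → GapDecreasing xs
gapDecreasing-++⁻ˡ []           _       = tt
gapDecreasing-++⁻ˡ (_ ∷ [])     _       = [] , tt
gapDecreasing-++⁻ˡ (_ ∷ b ∷ bs) (p , g) = Allₚ.++⁻ˡ bs p , gapDecreasing-++⁻ˡ (b ∷ bs) g

gapDecreasing-last : ∀ xs {u v} → GapDecreasing (xs ++ u ∷ v ∷ []) → All (v ≤_) xs
gapDecreasing-last []           _                = []
gapDecreasing-last (_ ∷ [])     ((v≤a ∷ []) , _) = v≤a ∷ []
gapDecreasing-last (_ ∷ b ∷ bs) (p , g) =
  All.head (All.tail (Allₚ.++⁻ʳ bs p)) ∷ gapDecreasing-last (b ∷ bs) g

unique-++⁻ˡ : ∀ xs {ys : List ℕ} → Unique (xs ++ ys) → Unique xs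
unique-++⁻ˡ []       _          = []
unique-++⁻ˡ (_ ∷ xs) (x∉ ∷ uxs) = Allₚ.++⁻ˡ xs x∉ ∷ unique-++⁻ˡ xs uxs

unique-last : ∀ xs {u v : ℕ} → Unique (xs ++ u ∷ v ∷ []) → All (_≢ v) xs × u ≢ v
unique-last []       ((u≢v ∷ []) ∷ _) = [] , u≢v
unique-last (_ ∷ xs) (x∉ ∷ uxs)       =
  All.head (All.tail (Allₚ.++⁻ʳ xs x∉)) ∷ proj₁ (unique-last xs uxs) , proj₂ (unique-last xs uxs)

_≢?_ : (a b : ℕ) → Dec (a ≢ b)
a ≢? b = ¬? (a ≟ b)

length≤1+length-filter≢ : ∀ x {xs} → Unique xs → length xs ≤ suc (length (filter (_≢? x) xs))
length≤1+length-filter≢ x {[]}     _          = z≤n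
length≤1+length-filter≢ x {a ∷ as} (a∉ ∷ uas) with a ≟ x
... | yes refl = ≤-reflexive (cong (suc ∘ length) (sym
      (trans (filter-reject (_≢? x) (λ x≢x → x≢x refl)) (filter-all (_≢? x) (All.map ≢-sym a∉)))))
... | no a≢x   = subst (λ l → suc (length as) ≤ suc (length l)) (sym (filter-accept (_≢? x) a≢x))
      (s≤s (length≤1+length-filter≢ x uas))

Unique∧Between⇒length≤ : ∀ lo hi {xs} → Unique xs → All (Between lo hi) xs → length xs ≤ hi ∸ lo
Unique∧Between⇒length≤ lo hi       {[]}     _ _                   = z≤n
Unique∧Between⇒length≤ lo zero     {a ∷ _}  _ ((lo<a , a≤0) ∷ _) = ⊥-elim (n≮0 (≤-trans lo<a a≤0))
Unique∧Between⇒length≤ lo (suc hi) {xs@(a ∷ _)} u btw@((lo<a , a≤) ∷ _) = begin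
  length xs         ≤⟨ length≤1+length-filter≢ (suc hi) u ⟩
  suc (length rest) ≤⟨ s≤s (Unique∧Between⇒length≤ lo hi (UP.filter⁺ (_≢? suc hi) u) btw-rest) ⟩
  suc (hi ∸ lo)     ≡⟨ sym (+-∸-assoc 1 (s≤s⁻¹ (≤-trans lo<a a≤))) ⟩
  suc hi ∸ lo       ∎
  where
  open ≤-Reasoning
  rest = filter (_≢? suc hi) xs
  btw-rest : All (Between lo hi) rest
  btw-rest = All.map (λ ((lo<b , b≤) , b≢) → lo<b , s≤s⁻¹ (≤∧≢⇒< b≤ b≢))
               (All.zip (Allₚ.filter⁺ (_≢? suc hi) btw , Allₚ.all-filter (_≢? suc hi) xs))

-- Otherwise the n + 1 distinct entries of π would all lie in (1, n + 1].
minimum≡1 : ∀ {n π w} → IsAv (suc n) π → w ∈ π → All (w ≤_) π → w ≡ 1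
minimum≡1 {n} (isAv len btw u _) w∈π w≤π = ≤-antisym w≤1 (proj₁ (All.lookup btw w∈π))
  where
  w≤1 = ≮⇒≥ (λ 1<w → <-irrefl len (s≤s (Unique∧Between⇒length≤ 1 (suc n) u
          (All.zipWith (λ (w≤x , (_ , x≤)) → <-≤-trans 1<w w≤x , x≤) (w≤π , btw)))))


-- Decomposition into skew sums with the layers 1 and 12

_⊖_ : List ℕ → List ℕ → List ℕ
σ ⊖ τ = map (length τ +_) σ ++ τ

isAv-⊖ : ∀ {n k σ τ} → IsAv n σ → IsAv k τ → IsAv (k + n) (σ ⊖ τ)
isAv-⊖ {n} {_} {σ} {τ} (isAv lenσ btwσ uσ gσ) (isAv refl btwτ uτ gτ) =
  isAv len btw
    (UP.++⁺ (UP.map⁺ (λ {x} {y} → +-cancelˡ-≡ k x y) uσ) uτ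
      (λ (v∈σ′ , v∈τ) → <⇒≱ (All.lookup above v∈σ′) (All.lookup τ≤k v∈τ)))
    (gapDecreasing-++ (gapDecreasing-map (+-monoʳ-≤ k) gσ) gτ
      (All.map (λ k<x → All.map (λ b≤k → ≤-trans b≤k (<⇒≤ k<x)) τ≤k) above))
  where
  k = length τ
  above : All (k <_) (map (k +_) σ)
  above = Allₚ.map⁺ (All.map (λ (0<a , _) → m<m+n k 0<a) btwσ)
  τ≤k : All (_≤ k) τ
  τ≤k = All.map proj₂ btwτ
  btw : All (Between 0 (k + n)) (σ ⊖ τ)
  btw = Allₚ.++⁺
    (Allₚ.map⁺ (All.map (λ (0<a , a≤n) → <-≤-trans 0<a (m≤n+m _ k) , +-monoʳ-≤ k a≤n) btwσ))
    (All.map (λ (0<b , b≤k) → 0<b , ≤-trans b≤k (m≤m+n k n)) btwτ)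
  len : length (σ ⊖ τ) ≡ k + n
  len = begin
    length (map (k +_) σ ++ τ)  ≡⟨ length-++ (map (k +_) σ) ⟩
    length (map (k +_) σ) + k   ≡⟨ cong (_+ k) (trans (length-map (k +_) σ) lenσ) ⟩
    n + k                       ≡⟨ +-comm n k ⟩
    k + n                       ∎
    where open ≡-Reasoning

map-+-∸ : ∀ k {xs} → All (k <_) xs → map (k +_) (map (_∸ k) xs) ≡ xs
map-+-∸ k []           = refl
map-+-∸ k (k<x ∷ k<xs) = cong₂ _∷_ (m+[n∸m]≡n (<⇒≤ k<x)) (map-+-∸ k k<xs)

isAv-⊖⁻ : ∀ {n ρ τ} → IsAv (length τ + n) (ρ ++ τ) → length ρ ≡ n → All (length τ <_) ρ →
  ∃[ σ ] IsAv n σ × σ ⊖ τ ≡ ρ ++ τ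
isAv-⊖⁻ {n} {ρ} {τ} (isAv _ btw u g) lenρ above =
  σ , isAv (trans (length-map _ ρ) lenρ) btwσ
           (UP.map⁻ (subst Unique (sym ρ≡) (unique-++⁻ˡ ρ u)))
           (gapDecreasing-map (∸-monoˡ-≤ k) (gapDecreasing-++⁻ˡ ρ g))
    , cong (_++ τ) ρ≡
  where
  k = length τ
  σ = map (_∸ k) ρ
  ρ≡ : map (k +_) σ ≡ ρ
  ρ≡ = map-+-∸ k above
  btwσ : All (Between 0 n) σ
  btwσ = Allₚ.map⁺ (All.zipWith (λ (k<x , (_ , x≤)) → m<n⇒0<n∸m k<x , m≤n+o⇒m∸n≤o _ k x≤)
                                (above , Allₚ.++⁻ˡ ρ btw))

data LastLayer (m : ℕ) : List ℕ → Set where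
  layer-1  : ∀ {σ} → IsAv (suc m) σ → LastLayer m (σ ⊖ (1 ∷ []))
  layer-12 : ∀ {σ} → IsAv m σ → LastLayer m (σ ⊖ (1 ∷ 2 ∷ []))

splitLastTwo : ∀ m (π : List ℕ) → length π ≡ 2 + m →
  ∃[ xs ] ∃[ u ] ∃[ v ] π ≡ xs ++ u ∷ v ∷ [] × length xs ≡ m
splitLastTwo zero    (u ∷ v ∷ []) refl = [] , u , v , refl , refl
splitLastTwo (suc m) (a ∷ π)      len
  with xs , u , v , refl , lenxs ← splitLastTwo m π (suc-injective len) =
  a ∷ xs , u , v , refl , cong suc lenxs

below-last : ∀ {k} xs {u v} → IsAv k (xs ++ u ∷ v ∷ []) → All (v <_) xs
below-last xs (isAv _ _ uniq g) = All.zipWith (λ (v≤x , x≢v) → ≤∧≢⇒< v≤x (≢-sym x≢v))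
                                              (gapDecreasing-last xs g , proj₁ (unique-last xs uniq))

-- The m entries before u v are distinct, exceed v and are at most m + 2.
last≤2 : ∀ {m} xs {u v} → length xs ≡ m → IsAv (2 + m) (xs ++ u ∷ v ∷ []) → v ≤ 2
last≤2 {m} xs {v = v} lenxs av@(isAv _ btw uniq _) =
  +-cancelˡ-≤ m v 2 (subst (m + v ≤_) (+-comm 2 m) (m≤o∸n⇒m+n≤o m v≤2+m m≤2+m∸v))
  where
  v≤2+m : v ≤ 2 + m
  v≤2+m = proj₂ (All.head (All.tail (Allₚ.++⁻ʳ xs btw)))
  m≤2+m∸v : m ≤ 2 + m ∸ v
  m≤2+m∸v = subst (_≤ 2 + m ∸ v) lenxs (Unique∧Between⇒length≤ v (2 + m) (unique-++⁻ˡ xs uniq)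
    (All.zipWith (λ (v<x , (_ , x≤)) → v<x , x≤) (below-last xs av , Allₚ.++⁻ˡ xs btw)))

lastLayer-++ : ∀ m xs {u v} → length xs ≡ m → IsAv (2 + m) (xs ++ u ∷ v ∷ []) →
  LastLayer m (xs ++ u ∷ v ∷ [])
lastLayer-++ m xs {u} {v} lenxs av with <-cmp u v
... | tri≈ _ u≡v _ = ⊥-elim (proj₂ (unique-last xs (IsAv.unique av)) u≡v)
... | tri> _ _ v<u
  with refl ← minimum≡1 av (∈-++⁺ʳ xs (there (here refl)))
                (Allₚ.++⁺ (All.map <⇒≤ (below-last xs av)) (<⇒≤ v<u ∷ ≤-refl ∷ []))
  with σ , avσ , σ⊖≡ ← isAv-⊖⁻ {τ = 1 ∷ []} (subst (IsAv (2 + m)) (sym (++-assoc xs _ _)) av)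
                         (trans (length-++-comm xs (u ∷ [])) (cong suc lenxs))
                         (Allₚ.++⁺ (below-last xs av) (v<u ∷ []))
  = subst (LastLayer m) (trans σ⊖≡ (++-assoc xs _ _)) (layer-1 avσ)
... | tri< u<v _ _
  with refl ← minimum≡1 av (∈-++⁺ʳ xs (here refl))
                (Allₚ.++⁺ (All.map (λ v<x → <⇒≤ (<-trans u<v v<x)) (below-last xs av))
                          (≤-refl ∷ <⇒≤ u<v ∷ []))
  with refl ← ≤-antisym (last≤2 xs lenxs av) u<v
  with σ , avσ , σ⊖≡ ← isAv-⊖⁻ av lenxs (below-last xs av)
  = subst (LastLayer m) σ⊖≡ (layer-12 avσ)

lastLayer : ∀ m {π} → IsAv (2 + m) π → LastLayer m π
lastLayer m {π} av with xs , u , v , refl , lenxs ← splitLastTwo m π (IsAv.length≡ av) =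
  lastLayer-++ m xs lenxs av

layered : ℕ → List (List ℕ)
layered zero          = [] ∷ []
layered (suc zero)    = (1 ∷ []) ∷ []
layered (suc (suc m)) = map (_⊖ (1 ∷ [])) (layered (suc m)) ++ map (_⊖ (1 ∷ 2 ∷ [])) (layered m)

isAv-1 : IsAv 1 (1 ∷ [])
isAv-1 = isAv refl ((z<s , ≤-refl) ∷ []) ([] ∷ []) ([] , tt)

isAv-12 : IsAv 2 (1 ∷ 2 ∷ [])
isAv-12 = isAv refl ((z<s , s≤s z≤n) ∷ (z<s , ≤-refl) ∷ []) (((λ ()) ∷ []) ∷ [] ∷ []) ([] , [] , tt)

∈layered⇒isAv : ∀ n {π} → π ∈ layered n → IsAv n π
∈layered⇒isAv zero          (here refl) = isAv refl [] [] tt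
∈layered⇒isAv (suc zero)    (here refl) = isAv-1
∈layered⇒isAv (suc (suc m)) = fromSkewSums (∈layered⇒isAv (suc m)) (∈layered⇒isAv m)
  where
  fromSkewSums : (∀ {σ} → σ ∈ layered (suc m) → IsAv (suc m) σ) → (∀ {σ} → σ ∈ layered m → IsAv m σ) →
    ∀ {π} → π ∈ layered (suc (suc m)) → IsAv (suc (suc m)) π
  fromSkewSums ih₁ ih₀ π∈ with ∈-++⁻ (map (_⊖ (1 ∷ [])) (layered (suc m))) π∈
  ... | inj₁ π∈₁ with σ , σ∈ , refl ← ∈-map⁻ _ π∈₁ = isAv-⊖ (ih₁ σ∈) isAv-1
  ... | inj₂ π∈₂ with σ , σ∈ , refl ← ∈-map⁻ _ π∈₂ = isAv-⊖ (ih₀ σ∈) isAv-12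

isAv⇒∈layered : ∀ n {π} → IsAv n π → π ∈ layered n
isAv⇒∈layered zero          {[]}        _               = here refl
isAv⇒∈layered zero          {_ ∷ _}     (isAv () _ _ _)
isAv⇒∈layered (suc zero)    {[]}        (isAv () _ _ _)
isAv⇒∈layered (suc zero)    {_ ∷ _ ∷ _} (isAv () _ _ _)
isAv⇒∈layered (suc zero)    {a ∷ []}    (isAv _ ((0<a , a≤1) ∷ []) _ _) =
  here (cong (_∷ []) (≤-antisym a≤1 0<a))
isAv⇒∈layered (suc (suc m)) av =
  fromLastLayer (isAv⇒∈layered (suc m)) (isAv⇒∈layered m) (lastLayer m av)
  where
  fromLastLayer : (∀ {σ} → IsAv (suc m) σ → σ ∈ layered (suc m)) → (∀ {σ} → IsAv m σ → σ ∈ layered m) →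
    ∀ {π} → LastLayer m π → π ∈ layered (suc (suc m))
  fromLastLayer ih₁ ih₀ (layer-1  avσ) = ∈-++⁺ˡ (∈-map⁺ _ (ih₁ avσ))
  fromLastLayer ih₁ ih₀ (layer-12 avσ) = ∈-++⁺ʳ _ (∈-map⁺ _ (ih₀ avσ))

⊖-injectiveˡ : ∀ τ {σ σ′} → σ ⊖ τ ≡ σ′ ⊖ τ → σ ≡ σ′
⊖-injectiveˡ τ {σ} {σ′} eq =
  map-injective (λ {x} {y} → +-cancelˡ-≡ (length τ) x y) (++-cancelʳ τ (map _ σ) (map _ σ′) eq)

layered-unique : ∀ n → Unique (layered n)
layered-unique zero          = [] ∷ []
layered-unique (suc zero)    = [] ∷ []
layered-unique (suc (suc m)) =
  UP.++⁺ (UP.map⁺ (⊖-injectiveˡ (1 ∷ [])) (layered-unique (suc m)))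
         (UP.map⁺ (⊖-injectiveˡ (1 ∷ 2 ∷ [])) (layered-unique m))
         endsDiffer
  where
  endsDiffer : ∀ {π} →
    ¬ (π ∈ map (_⊖ (1 ∷ [])) (layered (suc m)) × π ∈ map (_⊖ (1 ∷ 2 ∷ [])) (layered m))
  endsDiffer (π∈₁ , π∈₂) with σ , _ , refl ← ∈-map⁻ _ π∈₁ | σ′ , _ , eq ← ∈-map⁻ _ π∈₂
    with () ← ∷ʳ-injectiveʳ (map suc σ) (map (2 +_) σ′ ++ 1 ∷ [])
                (trans eq (sym (++-assoc (map (2 +_) σ′) _ _)))

Av↭layered : ∀ n → Av n ↭ layered n
Av↭layered n = ∼bag⇒↭ (unique∧set⇒bag (Av-unique n) (layered-unique n)
  (mk⇔ (isAv⇒∈layered n ∘ ∈Av⇒isAv n) (isAv⇒∈Av n ∘ ∈layered⇒isAv n)))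


-- Runs and major index of the skew sums

runsFrom-⊖1 : ∀ a r xs → runsFrom (suc a) r (map suc xs ++ 1 ∷ []) ≡ runsFrom a r xs ++ 1 ∷ []
runsFrom-⊖1 a r []       = refl
runsFrom-⊖1 a r (b ∷ bs) with a <ᵇ b
... | true  = runsFrom-⊖1 b (suc r) bs
... | false = cong (r ∷_) (runsFrom-⊖1 b 1 bs)

runsFrom-⊖12 : ∀ a r xs → runsFrom (2 + a) r (map (2 +_) xs ++ 1 ∷ 2 ∷ []) ≡ runsFrom a r xs ++ 2 ∷ []
runsFrom-⊖12 a r []       = refl
runsFrom-⊖12 a r (b ∷ bs) with a <ᵇ b
... | true  = runsFrom-⊖12 b (suc r) bs
... | false = cong (r ∷_) (runsFrom-⊖12 b 1 bs)

runs-⊖1 : ∀ σ → runs (σ ⊖ (1 ∷ [])) ≡ runs σ ++ 1 ∷ []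
runs-⊖1 []       = refl
runs-⊖1 (a ∷ as) = runsFrom-⊖1 a 1 as

runs-⊖12 : ∀ σ → runs (σ ⊖ (1 ∷ 2 ∷ [])) ≡ runs σ ++ 2 ∷ []
runs-⊖12 []       = refl
runs-⊖12 (a ∷ as) = runsFrom-⊖12 a 1 as

+-suc-shuffle : ∀ d m i l → d + (m + (suc i + l)) ≡ (d + m) + (i + suc l)
+-suc-shuffle d m i l = trans (sym (+-assoc d m _)) (cong ((d + m) +_) (sym (+-suc i l)))

-- Positivity is needed only here: the shifted last entry suc a must exceed the appended 1.
majFrom-⊖1 : ∀ i a xs → All (0 <_) (a ∷ xs) →
  majFrom i (suc a ∷ map suc xs ++ 1 ∷ []) ≡ majFrom i (a ∷ xs) + (i + length xs)
majFrom-⊖1 i (suc a) []       _            = refl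
majFrom-⊖1 i a       (b ∷ bs) (_ ∷ 0<b∷bs) =
  trans (cong ((if b <ᵇ a then i else 0) +_) (majFrom-⊖1 (suc i) b bs 0<b∷bs))
        (+-suc-shuffle (if b <ᵇ a then i else 0) (majFrom (suc i) (b ∷ bs)) i (length bs))

majFrom-⊖12 : ∀ i a xs →
  majFrom i (2 + a ∷ map (2 +_) xs ++ 1 ∷ 2 ∷ []) ≡ majFrom i (a ∷ xs) + (i + length xs)
majFrom-⊖12 i a []       = refl
majFrom-⊖12 i a (b ∷ bs) =
  trans (cong ((if b <ᵇ a then i else 0) +_) (majFrom-⊖12 (suc i) b bs))
        (+-suc-shuffle (if b <ᵇ a then i else 0) (majFrom (suc i) (b ∷ bs)) i (length bs))

maj-⊖1 : ∀ σ → All (0 <_) σ → maj (σ ⊖ (1 ∷ [])) ≡ maj σ + length σ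
maj-⊖1 []       _   = refl
maj-⊖1 (a ∷ as) pos = majFrom-⊖1 1 a as pos

maj-⊖12 : ∀ σ → maj (σ ⊖ (1 ∷ 2 ∷ [])) ≡ maj σ + length σ
maj-⊖12 []       = refl
maj-⊖12 (a ∷ as) = majFrom-⊖12 1 a as

countEq-++ : ∀ k xs ys → countEq k (xs ++ ys) ≡ countEq k xs + countEq k ys
countEq-++ k xs ys =
  trans (cong length (filter-++ (T? ∘ (k ≡ᵇ_)) xs ys)) (length-++ (filterᵇ (k ≡ᵇ_) xs))

record StatShift (i j k : ℕ) (π′ π : List ℕ) : Set where
  constructor statShift
  field
    sRuns-shift : sRuns π′ ≡ i + sRuns π
    dRuns-shift : dRuns π′ ≡ j + dRuns π
    maj-shift   : maj π′ ≡ k + maj π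

statShift-⊖1 : ∀ {n σ} → IsAv (suc n) σ → StatShift 1 0 (suc n) (σ ⊖ (1 ∷ [])) σ
statShift-⊖1 {n} {σ} (isAv len btw _ _) = statShift
  (trans (cong (countEq 1) (runs-⊖1 σ)) (trans (countEq-++ 1 (runs σ) _) (+-comm (sRuns σ) 1)))
  (trans (cong (countEq 2) (runs-⊖1 σ)) (trans (countEq-++ 2 (runs σ) _) (+-identityʳ (dRuns σ))))
  (trans (maj-⊖1 σ (All.map proj₁ btw)) (trans (cong (maj σ +_) len) (+-comm (maj σ) (suc n))))

statShift-⊖12 : ∀ {n σ} → length σ ≡ n → StatShift 0 1 n (σ ⊖ (1 ∷ 2 ∷ [])) σ
statShift-⊖12 {n} {σ} len = statShift
  (trans (cong (countEq 1) (runs-⊖12 σ)) (trans (countEq-++ 1 (runs σ) _) (+-identityʳ (sRuns σ))))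
  (trans (cong (countEq 2) (runs-⊖12 σ)) (trans (countEq-++ 2 (runs σ) _) (+-comm (dRuns σ) 1)))
  (trans (maj-⊖12 σ) (trans (cong (maj σ +_) len) (+-comm (maj σ) n)))


-- Generating polynomials

+-≡ᵇ : ∀ k m c → (k + m ≡ᵇ c) ≡ (k ≤ᵇ c) ∧ (m ≡ᵇ c ∸ k)
+-≡ᵇ zero          m c       = refl
+-≡ᵇ (suc k)       m zero    = refl
+-≡ᵇ (suc zero)    m (suc c) = refl
+-≡ᵇ (suc (suc k)) m (suc c) = +-≡ᵇ (suc k) m c

statIs : ℕ → ℕ → ℕ → List ℕ → Bool
statIs a b c π = (sRuns π ≡ᵇ a) ∧ (dRuns π ≡ᵇ b) ∧ (maj π ≡ᵇ c)

statIs-shift : ∀ {i j k π′ π} a b c → StatShift i j k π′ π →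
  statIs a b c π′ ≡ ((i ≤ᵇ a) ∧ (j ≤ᵇ b) ∧ (k ≤ᵇ c)) ∧ statIs (a ∸ i) (b ∸ j) (c ∸ k) π
statIs-shift {i} {j} {k} {π′} {π} a b c (statShift s d m) = begin
  statIs a b c π′
    ≡⟨ cong₂ _∧_ (trans (cong (_≡ᵇ a) s) (+-≡ᵇ i _ a))
         (cong₂ _∧_ (trans (cong (_≡ᵇ b) d) (+-≡ᵇ j _ b))
                    (trans (cong (_≡ᵇ c) m) (+-≡ᵇ k _ c))) ⟩
  ((i ≤ᵇ a) ∧ S) ∧ ((j ≤ᵇ b) ∧ D) ∧ ((k ≤ᵇ c) ∧ M)
    ≡⟨ cong (((i ≤ᵇ a) ∧ S) ∧_) (∧-interchange (j ≤ᵇ b) D (k ≤ᵇ c) M) ⟩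
  ((i ≤ᵇ a) ∧ S) ∧ ((j ≤ᵇ b) ∧ (k ≤ᵇ c)) ∧ (D ∧ M)
    ≡⟨ ∧-interchange (i ≤ᵇ a) S _ _ ⟩
  ((i ≤ᵇ a) ∧ (j ≤ᵇ b) ∧ (k ≤ᵇ c)) ∧ (S ∧ D ∧ M) ∎
  where
  open ≡-Reasoning
  S = sRuns π ≡ᵇ a ∸ i
  D = dRuns π ≡ᵇ b ∸ j
  M = maj π ≡ᵇ c ∸ k

-- FM n is genPoly (Av n) by definition.
genPoly : List (List ℕ) → Poly
genPoly πs a b c = length (filterᵇ (statIs a b c) πs)

genPoly-↭ : ∀ {πs πs′} → πs ↭ πs′ → genPoly πs ≈P genPoly πs′
genPoly-↭ πs↭πs′ a b c = ↭-length (filter-↭ (T? ∘ statIs a b c) πs↭πs′)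

genPoly-++ : ∀ πs πs′ → genPoly (πs ++ πs′) ≈P (genPoly πs +P genPoly πs′)
genPoly-++ πs πs′ a b c =
  trans (cong length (filter-++ (T? ∘ statIs a b c) πs πs′)) (length-++ (filterᵇ (statIs a b c) πs))

length-filterᵇ-map : ∀ {A B : Set} (p : B → Bool) (q : A → Bool) (f : A → B) {xs} →
  All (λ x → p (f x) ≡ q x) xs → length (filterᵇ p (map f xs)) ≡ length (filterᵇ q xs)
length-filterᵇ-map p q f {[]}     []       = refl
length-filterᵇ-map p q f {x ∷ xs} (e ∷ es) with p (f x) | q x
length-filterᵇ-map p q f {x ∷ xs} (refl ∷ es) | true  | .true  = cong suc (length-filterᵇ-map p q f es)
length-filterᵇ-map p q f {x ∷ xs} (refl ∷ es) | false | .false = length-filterᵇ-map p q f es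

length-filterᵇ-guard : ∀ {A : Set} t (q : A → Bool) xs →
  length (filterᵇ (λ x → t ∧ q x) xs) ≡ (if t then length (filterᵇ q xs) else 0)
length-filterᵇ-guard true  q xs       = refl
length-filterᵇ-guard false q []       = refl
length-filterᵇ-guard false q (_ ∷ xs) = length-filterᵇ-guard false q xs

genPoly-map : ∀ {i j k} {f : List ℕ → List ℕ} {πs} → All (λ σ → StatShift i j k (f σ) σ) πs →
  genPoly (map f πs) ≈P mulMono i j k (genPoly πs)
genPoly-map {i} {j} {k} {f} {πs} shifts a b c =
  trans (length-filterᵇ-map (statIs a b c) (λ σ → guard ∧ statIs (a ∸ i) (b ∸ j) (c ∸ k) σ) f
                            (All.map (statIs-shift a b c) shifts))
        (length-filterᵇ-guard guard (statIs (a ∸ i) (b ∸ j) (c ∸ k)) πs)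
  where guard = (i ≤ᵇ a) ∧ (j ≤ᵇ b) ∧ (k ≤ᵇ c)

mulMono-cong : ∀ i j k {P Q} → P ≈P Q → mulMono i j k P ≈P mulMono i j k Q
mulMono-cong i j k P≈Q a b c =
  cong (if (i ≤ᵇ a) ∧ (j ≤ᵇ b) ∧ (k ≤ᵇ c) then_else 0) (P≈Q (a ∸ i) (b ∸ j) (c ∸ k))

FM-recurrence : ∀ m → FM (suc (suc m)) ≈P (mulMono 1 0 (suc m) (FM (suc m)) +P mulMono 0 1 m (FM m))
FM-recurrence m a b c = begin
  FM (suc (suc m)) a b c
    ≡⟨ genPoly-↭ (Av↭layered (suc (suc m))) a b c ⟩
  genPoly (map (_⊖ (1 ∷ [])) (layered (suc m)) ++ map (_⊖ (1 ∷ 2 ∷ [])) (layered m)) a b c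
    ≡⟨ genPoly-++ (map (_⊖ (1 ∷ [])) (layered (suc m))) _ a b c ⟩
  genPoly (map (_⊖ (1 ∷ [])) (layered (suc m))) a b c
    + genPoly (map (_⊖ (1 ∷ 2 ∷ [])) (layered m)) a b c
    ≡⟨ cong₂ _+_ (genPoly-map (All.map statShift-⊖1 (isAvs (suc m))) a b c)
                 (genPoly-map (All.map (statShift-⊖12 ∘ IsAv.length≡) (isAvs m)) a b c) ⟩
  mulMono 1 0 (suc m) (genPoly (layered (suc m))) a b c + mulMono 0 1 m (genPoly (layered m)) a b c
    ≡⟨ cong₂ _+_ (mulMono-cong 1 0 (suc m) (genPoly-↭ (↭-sym (Av↭layered (suc m)))) a b c)
                 (mulMono-cong 0 1 m (genPoly-↭ (↭-sym (Av↭layered m))) a b c) ⟩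
  mulMono 1 0 (suc m) (FM (suc m)) a b c + mulMono 0 1 m (FM m) a b c ∎
  where
  open ≡-Reasoning
  isAvs : ∀ n → All (IsAv n) (layered n)
  isAvs n = All.tabulate (∈layered⇒isAv n)

-- Av 0 and Av 1 evaluate to [[]] and [[1]].
FM-0 : FM 0 ≈P mono 0 0 0
FM-0 zero    zero    zero    = refl
FM-0 zero    zero    (suc c) = refl
FM-0 zero    (suc b) c       = refl
FM-0 (suc a) b       c       = refl

FM-1 : FM 1 ≈P mono 1 0 0
FM-1 zero          b       c       = refl
FM-1 (suc zero)    zero    zero    = refl
FM-1 (suc zero)    zero    (suc c) = refl
FM-1 (suc zero)    (suc b) c       = refl
FM-1 (suc (suc a)) b       c       = refl

theorem2p2 : (FM 0 ≈P mono 0 0 0)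
    × (FM 1 ≈P mono 1 0 0)
    × (∀ (n : ℕ) → FM (n + 2) ≈P (mulMono 1 0 (n + 1) (FM (n + 1)) +P mulMono 0 1 n (FM n)))
theorem2p2 = FM-0 , FM-1 , recurrence
  where
  recurrence : ∀ n → FM (n + 2) ≈P (mulMono 1 0 (n + 1) (FM (n + 1)) +P mulMono 0 1 n (FM n))
  recurrence n rewrite +-comm n 2 | +-comm n 1 = FM-recurrence n
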